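{- Let $S$ be a facet of $\mathcal{T}_m$ and $\Delta_S$ the simplex spanned by the lattice points corresponding to $S$. Then the number of facets of $\Delta_S$ visible from $\widetilde{q}$ equals the number of edges $e_i$ ($i\in[m]$) that are squiggly or double in $S$.
   Context: Let $m\ge1$ and let $I_m$ be the graph on $\{1,2\}$ with exactly $m$ parallel edges $e_1,\ldots,e_m$ between $1$ and $2$. Its cosmological polytope $\mathcal{C}_{I_m}\subset\mathbb{R}^{\{1,2\}\cup\{e_1,\ldots,e_m\}}$ is the convex hull of $\mathbf{e}_1+\mathbf{e}_2-\mathbf{e}_{e_i}$, $\mathbf{e}_1-\mathbf{e}_2+\mathbf{e}_{e_i}$, $-\mathbf{e}_1+\mathbf{e}_2+\mathbf{e}_{e_i}$ ($i\in[m]$). Variables: $z_1,z_2$ (for $\mathbf{e}_1,\mathbf{e}_2$), and for each $i$: $z_{e_i}$ (for $\mathbf{e}_{e_i}$), $t_i$ (for $\mathbf{e}_1+\mathbf{e}_2-\mathbf{e}_{e_i}$), $\overrightarrow{y}_i$ (for $\mathbf{e}_1-\mathbf{e}_2+\mathbf{e}_{e_i}$), $\overleftarrow{y}_i$ (for $-\mathbf{e}_1+\mathbf{e}_2+\mathbf{e}_{e_i}$); $V(e_i)=\{\overrightarrow{y}_i,\overleftarrow{y}_i,t_i,z_{e_i}\}$. Let $<$ be the lexicographic order induced by $\overrightarrow{y}_1>\cdots>\overrightarrow{y}_m>\overleftarrow{y}_m>\cdots>\overleftarrow{y}_1>z_{e_1}>\cdots>z_{e_m}>t_1>\cdots>t_m>z_1>z_2$.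 Let $B$ consist of, for each $i$: $\overrightarrow{y}_i\overleftarrow{y}_i-z_{e_i}^2$, $\overrightarrow{y}_it_i-z_1^2$, $\overleftarrow{y}_it_i-z_2^2$, $\overrightarrow{y}_iz_2-z_1z_{e_i}$, $\overleftarrow{y}_iz_1-z_2z_{e_i}$, $t_iz_{e_i}-z_1z_2$; and for each $i\ne k$: $\overrightarrow{y}_i\overleftarrow{y}_k-z_{e_i}z_{e_k}$, $\overrightarrow{y}_iz_{e_k}-\overrightarrow{y}_kz_{e_i}$, $\overleftarrow{y}_iz_{e_k}-\overleftarrow{y}_kz_{e_i}$. A facet of $\mathcal{T}_m$ is a set $S$ of $m+2$ variables not containing all variables of the $<$-leading monomial of any binomial in $B$; the corresponding simplices form a unimodular triangulation of $\mathcal{C}_{I_m}$. An edge $e_i$ is squiggly in $S$ if $t_i\in S$ and double in $S$ if $|S\cap V(e_i)|=2$. Define $\widetilde{q}$ by $\widetilde{q}_1=\widetilde{q}_2=\frac12\cdot\frac{2+1/2}{3}$ and $\widetilde{q}_{e_i}=\frac1m\cdot\frac{1/2}{3}$ for $i\in[m]$. A facet $F$ of a full-dimensional simplex $\Delta\subseteq\mathcal{C}_{I_m}$ is visible from $\widetilde{q}$ if $\widetilde{q}\notin\mathrm{aff}(F)$ and $\widetilde{q}$ and $\Delta$ lie on opposite sides of $\mathrm{aff}(F)$ within $\mathrm{aff}(\mathcal{C}_{I_m})$. -}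

module Defs where

open import Data.Bool using (Bool; true; false; if_then_else_; _∨_)
open import Data.Nat as ℕ using (ℕ; zero; suc; _∸_; NonZero)
open import Data.Fin as Fin using (Fin; toℕ)
open import Data.Integer using (+_)
open import Data.Rational using (ℚ; 0ℚ; 1ℚ; _+_; _*_; -_; _/_; _<_)
open import Data.List using (List; []; _∷_; length)
open import Data.List.Membership.Propositional using (_∈_)
open import Data.List.Relation.Unary.Unique.Propositional using (Unique)
open import Data.List.Relation.Unary.All using (All)
open import Data.Product using (Σ; _×_; _,_; ∃)
open import Data.Sum using (_⊎_)
open import Relation.Nullary using (¬_; does)
open import Relation.Binary.PropositionalEquality using (_≡_; _≢_)
open import Function.Bundles using (_⇔_)

data Kind : Set where
  kz kt kyr kyl : Kind
  -- kz i  = z_{e_i},  kt i = t_i,  kyr i = →y_i,  kyl i = ←y_i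

data Var (m : ℕ) : Set where
  z₁ z₂ : Var m
  ev    : Kind → Fin m → Var m

pattern ze i  = ev kz i
pattern tt i  = ev kt i
pattern yr i  = ev kyr i
pattern yl i  = ev kyl i

-- The variable order
--   →y_1 > ... > →y_m > ←y_m > ... > ←y_1 > z_{e_1} > ... > z_{e_m}
--   > t_1 > ... > t_m > z_1 > z_2
-- encoded by a rank (bigger rank = bigger variable; Fin is 0-based).

rank : {m : ℕ} → Var m → ℕ
rank     z₂       = 0
rank     z₁       = 1
rank {m} (tt i)   = 2 ℕ.+ (m ∸ suc (toℕ i))
rank {m} (ze i)   = 2 ℕ.+ m ℕ.+ (m ∸ suc (toℕ i))
rank {m} (yl i)   = 2 ℕ.+ 2 ℕ.* m ℕ.+ toℕ i
rank {m} (yr i)   = 2 ℕ.+ 3 ℕ.* m ℕ.+ (m ∸ suc (toℕ i))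

Mon : ℕ → Set
Mon m = List (Var m)

kindEq : Kind → Kind → Bool
kindEq kz kz = true
kindEq kt kt = true
kindEq kyr kyr = true
kindEq kyl kyl = true
kindEq _ _ = false

varEq : {m : ℕ} → Var m → Var m → Bool
varEq z₁ z₁ = true
varEq z₂ z₂ = true
varEq (ev k i) (ev l j) = if kindEq k l then does (i Fin.≟ j) else false
varEq _ _ = false

countB : {A : Set} → (A → Bool) → List A → ℕ
countB p [] = 0
countB p (x ∷ xs) = if p x then suc (countB p xs) else countB p xs

expo : {m : ℕ} → Mon m → Var m → ℕ
expo M x = countB (varEq x) M

_<lex_ : {m : ℕ} → Mon m → Mon m → Set
_<lex_ {m} N M = Σ (Var m) λ x →
  (expo N x ℕ.< expo M x) × (∀ y → rank x ℕ.< rank y → expo M y ≡ expo N y)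

-- The binomials B (as pairs of monomials  u - v)

data Binom (m : ℕ) : Set where
  b1 b2 b3 b4 b5 b6 : Fin m → Binom m
  b7 b8 b9 : (i k : Fin m) → i ≢ k → Binom m

terms : {m : ℕ} → Binom m → Mon m × Mon m
terms (b1 i) = (yr i ∷ yl i ∷ []) , (ze i ∷ ze i ∷ [])
terms (b2 i) = (yr i ∷ tt i ∷ []) , (z₁ ∷ z₁ ∷ [])
terms (b3 i) = (yl i ∷ tt i ∷ []) , (z₂ ∷ z₂ ∷ [])
terms (b4 i) = (yr i ∷ z₂ ∷ []) , (z₁ ∷ ze i ∷ [])
terms (b5 i) = (yl i ∷ z₁ ∷ []) , (z₂ ∷ ze i ∷ [])
terms (b6 i) = (tt i ∷ ze i ∷ []) , (z₁ ∷ z₂ ∷ [])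
terms (b7 i k _) = (yr i ∷ yl k ∷ []) , (ze i ∷ ze k ∷ [])
terms (b8 i k _) = (yr i ∷ ze k ∷ []) , (yr k ∷ ze i ∷ [])
terms (b9 i k _) = (yl i ∷ ze k ∷ []) , (yl k ∷ ze i ∷ [])

ContainsLeading : {m : ℕ} → List (Var m) → Mon m → Mon m → Set
ContainsLeading S u v =
  (v <lex u × All (_∈ S) u) ⊎ (u <lex v × All (_∈ S) v)

IsFacet : (m : ℕ) → List (Var m) → Set
IsFacet m S =
  Unique S × length S ≡ 2 ℕ.+ m ×
  (∀ (b : Binom m) → ¬ ContainsLeading S (Data.Product.proj₁ (terms b))
                                         (Data.Product.proj₂ (terms b)))

-- Geometry: coordinates R^{1,2,e_1,...,e_m} = ℚ^(Fin (2+m)),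
-- coordinate 0 ↔ 1, coordinate 1 ↔ 2, coordinate 2+i ↔ e_i.

Pt : ℕ → Set
Pt m = Fin (2 ℕ.+ m) → ℚ

basis : {m : ℕ} → Fin (2 ℕ.+ m) → Pt m
basis j k = if does (j Fin.≟ k) then 1ℚ else 0ℚ

c₁ c₂ : {m : ℕ} → Fin (2 ℕ.+ m)
c₁ = Fin.zero
c₂ = Fin.suc Fin.zero

cE : {m : ℕ} → Fin m → Fin (2 ℕ.+ m)
cE i = Fin.suc (Fin.suc i)

_⊕_ _⊖_ : {m : ℕ} → Pt m → Pt m → Pt m
(p ⊕ q) k = p k + q k
(p ⊖ q) k = p k + (- q k)

point : {m : ℕ} → Var m → Pt m
point z₁ = basis c₁
point z₂ = basis c₂
point (ze i) = basis (cE i)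
point (tt i) = (basis c₁ ⊕ basis c₂) ⊖ basis (cE i)
point (yr i) = (basis c₁ ⊖ basis c₂) ⊕ basis (cE i)
point (yl i) = (basis c₂ ⊖ basis c₁) ⊕ basis (cE i)

qt : (m : ℕ) → .{{NonZero m}} → Pt m
qt m k with k
... | Fin.zero = (+ 1 / 2) * ((+ 2 / 1 + + 1 / 2) * (+ 1 / 3))
... | Fin.suc Fin.zero = (+ 1 / 2) * ((+ 2 / 1 + + 1 / 2) * (+ 1 / 3))
... | Fin.suc (Fin.suc _) = (+ 1 / m) * ((+ 1 / 2) * (+ 1 / 3))

∑ : {n : ℕ} → (Fin n → ℚ) → ℚ
∑ {zero} f = 0ℚ
∑ {suc n} f = f Fin.zero + ∑ (λ k → f (Fin.suc k))

affine : {m : ℕ} → Pt m → ℚ → Pt m → ℚ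
affine a c x = ∑ (λ k → a k * x k) + c

-- The facet of Δ_S opposite to the vertex (point v), v ∈ S, is visible
-- from q: there is an affine hyperplane (zero set of an affine functional)
-- containing the remaining vertices, with q strictly on one side and the
-- vertex v (hence Δ_S ∖ F) strictly on the other side.
VisibleFacet : {m : ℕ} → Pt m → List (Var m) → Var m → Set
VisibleFacet {m} q S v =
  Σ (Pt m) λ a → Σ ℚ λ c →
    (∀ w → w ∈ S → w ≢ v → affine a c (point w) ≡ 0ℚ) ×
    (0ℚ < affine a c (point v)) ×
    (affine a c q < 0ℚ)

inEdge : {m : ℕ} → Fin m → Var m → Bool
inEdge i (ev _ j) = does (i Fin.≟ j)
inEdge i _ = false

Squiggly : {m : ℕ} → List (Var m) → Fin m → Set
Squiggly S i = tt i ∈ S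

Double : {m : ℕ} → List (Var m) → Fin m → Set
Double S i = countB (inEdge i) S ≡ 2

NumberOf : {A : Set} → (A → Set) → ℕ → Set
NumberOf {A} P n =
  Σ (List A) λ L → Unique L × (∀ x → (x ∈ L) ⇔ P x) × length L ≡ n

{-# OPTIONS --safe #-}
-- The m+2 vertices of Δ_S lie on the hyperplane Σx = 1, where affine functionals act as linear
-- ones. Each binomial of B forbids a pair of variables in S: an edge meets S in at most two
-- variables, and in two only as z_{e_i} with →y_i or ←y_i (a right or left double); there is at
-- most one double; →y excludes z₂ and ←y excludes z₁. Sending the z_e of a double to the coordinate
-- of the excluded z, and every other variable to its own coordinate, is injective on S and hence
-- onto the m+2 coordinates: every edge meets S, z₁ ∈ S unless there is a left double, and z₂ ∈ S
-- unless there is a right double.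
--
-- The facet opposite v is visible exactly when v is some t_i or the y of a double; for those v an
-- explicit functional separates v from q̃. For any other v, a functional vanishing on the opposite
-- facet and positive at v is ≥ 0 on S and vanishes at the visible vertices. Every coordinate
-- vector is w + u − v′ with w, u on the nonnegative side and v′ visible, so the functional has
-- nonnegative coefficients and cannot be negative at q̃. Sending a visible vertex to its edge then
-- matches the visible facets with the squiggly or double edges.

module Submission where

open import Defs
open import Data.Bool using (Bool; true; false; T; if_then_else_)
open import Data.Fin as Fin using (Fin; zero; suc; toℕ; punchOut)
open import Data.Fin.Properties
  using (any?; injective⇒≤; punchOut-injective; toℕ<n; toℕ-injective; opposite-prop)
open import Data.Integer as ℤ using (1ℤ)
import Data.Integer.Properties as ℤₚ
open import Data.List using (List; []; _∷_; length; lookup; filter; map; allFin)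
open import Data.List.Properties using (length-map)
import Data.List.Membership.DecPropositional as DecMembership
open import Data.List.Membership.Propositional using (_∈_; _∉_)
open import Data.List.Membership.Propositional.Properties
  using (∈-lookup; ∈-filter⁺; ∈-filter⁻; ∈-map⁺; ∈-map⁻; ∈-allFin)
open import Data.List.Relation.Binary.Subset.Propositional using (_⊆_)
open import Data.List.Relation.Unary.All as All using (All; []; _∷_)
open import Data.List.Relation.Unary.AllPairs using ([]; _∷_)
open import Data.List.Relation.Unary.Any using (here; there; index)
open import Data.List.Relation.Unary.Any.Properties using (lookup-index)
open import Data.List.Relation.Unary.Unique.Propositional using (Unique)
open import Data.List.Relation.Unary.Unique.Propositional.Properties using (filter⁺; map⁺; allFin⁺)
open import Data.Nat as ℕ using (ℕ; NonZero; z≤n; s≤s)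
open import Data.Nat.Coprimality using (1-coprimeTo) renaming (sym to coprime-sym)
import Data.Nat.Properties as ℕₚ
open import Data.Product using (Σ; _×_; _,_; proj₁; proj₂; ∃-syntax)
open import Data.Rational
  using (ℚ; mkℚ; 0ℚ; 1ℚ; _+_; _*_; -_; _/_; 1/_; _≤_; _<_; _<?_; _≤?_; positive; nonNegative)
open import Data.Rational.Properties
  using ( ≤-refl; ≤-reflexive; <⇒≤; <-irrefl; <-≤-trans; +-identityˡ; +-identityʳ; +-mono-≤; +-mono-<-≤
        ; *-comm; *-identityˡ; *-identityʳ; *-zeroˡ; *-zeroʳ; *-distribˡ-+; *-distribʳ-+; *-inverseʳ
        ; neg-distrib-+; neg-distribˡ-*; neg-distribʳ-*; neg-antimono-<; *-monoʳ-≤-nonNeg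
        ; positive⁻¹; nonNegative⁻¹; nonNeg*nonNeg⇒nonNeg; pos*pos⇒pos; normalize-pos; /-cong; ↥p/↧p≡p)
open import Data.Rational.Solver using (module +-*-Solver)
open import Data.Sum using (_⊎_; inj₁; inj₂; [_,_]′)
open import Function using (_∘_)
open import Function.Bundles using (_⇔_; mk⇔; Equivalence)
open import Function.Definitions using (Injective)
open import Relation.Binary.Definitions using (DecidableEquality; tri<; tri≈; tri>)
open import Relation.Binary.PropositionalEquality
  using (_≡_; _≢_; refl; sym; trans; cong; cong₂; subst; subst₂; module ≡-Reasoning)
open import Relation.Nullary using (¬_; Dec; yes; no; does; contradiction)
open import Relation.Nullary.Decidable using (T?; map′; True; toWitness; _⊎-dec_; dec-true; dec-false)

open +-*-Solver using (solve; _:+_; :-_; _:=_)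

module _ {A : Set} where

  InjectiveOn : {B : Set} → (A → B) → List A → Set
  InjectiveOn f xs = ∀ {x y} → x ∈ xs → y ∈ xs → f x ≡ f y → x ≡ y

  lookup-injective : {xs : List A} → Unique xs → Injective _≡_ _≡_ (lookup xs)
  lookup-injective {_ ∷ _} _               {zero}  {zero}  _  = refl
  lookup-injective {_ ∷ _} (x∉xs ∷ _)      {zero}  {suc j} eq = contradiction eq (All.lookup x∉xs (∈-lookup j))
  lookup-injective {_ ∷ _} (x∉xs ∷ _)      {suc i} {zero}  eq = contradiction (sym eq) (All.lookup x∉xs (∈-lookup i))
  lookup-injective {_ ∷ _} (_ ∷ xs-unique) {suc i} {suc j} eq = cong suc (lookup-injective xs-unique eq)

  Unique-⊆⇒length≤ : {xs ys : List A} → Unique xs → xs ⊆ ys → length xs ℕ.≤ length ys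
  Unique-⊆⇒length≤ {xs} {ys} xs-unique xs⊆ys = injective⇒≤ position-injective
    where
    position : Fin (length xs) → Fin (length ys)
    position i = index (xs⊆ys (∈-lookup i))

    lookup-position : ∀ i → lookup xs i ≡ lookup ys (position i)
    lookup-position i = lookup-index (xs⊆ys (∈-lookup i))

    position-injective : Injective _≡_ _≡_ position
    position-injective {i} {j} eq = lookup-injective xs-unique (begin
      lookup xs i            ≡⟨ lookup-position i ⟩
      lookup ys (position i) ≡⟨ cong (lookup ys) eq ⟩
      lookup ys (position j) ≡⟨ lookup-position j ⟨
      lookup xs j            ∎)
      where open ≡-Reasoning

  Unique⇒length≡2 : {xs : List A} {a b : A} → Unique xs → a ≢ b → a ∈ xs → b ∈ xs →
                    (∀ {x} → x ∈ xs → x ≡ a ⊎ x ≡ b) → length xs ≡ 2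
  Unique⇒length≡2 {a = a} {b} xs-unique a≢b a∈xs b∈xs only-a-b = ℕₚ.≤-antisym
    (Unique-⊆⇒length≤ {ys = a ∷ b ∷ []} xs-unique λ x∈xs → [ here , there ∘ here ]′ (only-a-b x∈xs))
    (Unique-⊆⇒length≤ {a ∷ b ∷ []} ((a≢b ∷ []) ∷ [] ∷ []) λ where
      (here refl)         → a∈xs
      (there (here refl)) → b∈xs)

  length≡2⇒two-elements : {xs : List A} → Unique xs → length xs ≡ 2 →
                          ∃[ a ] ∃[ b ] a ≢ b × a ∈ xs × b ∈ xs
  length≡2⇒two-elements {a ∷ b ∷ []} ((a≢b ∷ []) ∷ _) refl = a , b , a≢b , here refl , there (here refl)

  countB≡length∘filter : (p : A → Bool) (xs : List A) → countB p xs ≡ length (filter (T? ∘ p) xs)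
  countB≡length∘filter p [] = refl
  countB≡length∘filter p (x ∷ xs) with p x
  ... | true  = cong ℕ.suc (countB≡length∘filter p xs)
  ... | false = countB≡length∘filter p xs

injective⇒surjective : ∀ {m n} {f : Fin m → Fin n} → n ℕ.≤ m → Injective _≡_ _≡_ f →
                       ∀ k → ∃[ i ] f i ≡ k
injective⇒surjective {m} {ℕ.suc n} {f} n<m f-injective k with any? (λ i → f i Fin.≟ k)
... | yes hit = hit
... | no miss = contradiction n<m (ℕₚ.≤⇒≯ (injective⇒≤ punched-injective))
  where
  punched : Fin m → Fin n
  punched i = punchOut {i = k} {j = f i} (λ k≡fi → miss (i , sym k≡fi))

  punched-injective : Injective _≡_ _≡_ punched
  punched-injective eq = f-injective (punchOut-injective {i = k} _ _ eq)

injectiveOn⇒surjective : ∀ {A : Set} {n} {xs : List A} {f : A → Fin n} →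
                         Unique xs → n ℕ.≤ length xs → InjectiveOn f xs →
                         ∀ k → ∃[ x ] x ∈ xs × f x ≡ k
injectiveOn⇒surjective {xs = xs} {f} xs-unique n≤ f-injective k
  with i , fi≡k ← injective⇒surjective {f = f ∘ lookup xs} n≤
         (lookup-injective xs-unique ∘ f-injective (∈-lookup _) (∈-lookup _)) k
  = lookup xs i , ∈-lookup i , fi≡k

∑-cong : ∀ {n} {f g : Fin n → ℚ} → (∀ k → f k ≡ g k) → ∑ f ≡ ∑ g
∑-cong {ℕ.zero}  _   = refl
∑-cong {ℕ.suc n} f≗g = cong₂ _+_ (f≗g zero) (∑-cong (f≗g ∘ suc))

∑-+ : ∀ {n} (f g : Fin n → ℚ) → ∑ (λ k → f k + g k) ≡ ∑ f + ∑ g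
∑-+ {ℕ.zero}  _ _ = refl
∑-+ {ℕ.suc n} f g = begin
  (f zero + g zero) + ∑ (λ k → f (suc k) + g (suc k))
    ≡⟨ cong ((f zero + g zero) +_) (∑-+ (f ∘ suc) (g ∘ suc)) ⟩
  (f zero + g zero) + (∑ (f ∘ suc) + ∑ (g ∘ suc))
    ≡⟨ interchange (f zero) (g zero) (∑ (f ∘ suc)) (∑ (g ∘ suc)) ⟩
  (f zero + ∑ (f ∘ suc)) + (g zero + ∑ (g ∘ suc))
    ∎
  where
  open ≡-Reasoning
  interchange : ∀ a b c d → (a + b) + (c + d) ≡ (a + c) + (b + d)
  interchange = solve 4 (λ a b c d → (a :+ b) :+ (c :+ d) := (a :+ c) :+ (b :+ d)) refl

∑-neg : ∀ {n} (f : Fin n → ℚ) → ∑ (λ k → - f k) ≡ - ∑ f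
∑-neg {ℕ.zero}  _ = refl
∑-neg {ℕ.suc n} f =
  trans (cong (- f zero +_) (∑-neg (f ∘ suc))) (sym (neg-distrib-+ (f zero) (∑ (f ∘ suc))))

∑-*ˡ : ∀ {n} c (f : Fin n → ℚ) → ∑ (λ k → c * f k) ≡ c * ∑ f
∑-*ˡ {ℕ.zero}  c _ = sym (*-zeroʳ c)
∑-*ˡ {ℕ.suc n} c f =
  trans (cong (c * f zero +_) (∑-*ˡ c (f ∘ suc))) (sym (*-distribˡ-+ c (f zero) (∑ (f ∘ suc))))

∑-nonneg : ∀ {n} {f : Fin n → ℚ} → (∀ k → 0ℚ ≤ f k) → 0ℚ ≤ ∑ f
∑-nonneg {ℕ.zero}  _      = ≤-refl
∑-nonneg {ℕ.suc n} f≥0 = +-mono-≤ (f≥0 zero) (∑-nonneg (f≥0 ∘ suc))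

∑-nonpos : ∀ {n} {f : Fin n → ℚ} → (∀ k → f k ≤ 0ℚ) → ∑ f ≤ 0ℚ
∑-nonpos {ℕ.zero}  _      = ≤-refl
∑-nonpos {ℕ.suc n} f≤0 = +-mono-≤ (f≤0 zero) (∑-nonpos (f≤0 ∘ suc))

balance : ∀ {w x y z} → w + x ≡ y + z → w ≡ 0ℚ → 0ℚ ≤ y → 0ℚ ≤ z → 0ℚ ≤ x
balance {w} {x} eq w≡0 0≤y 0≤z =
  subst (0ℚ ≤_) (trans (sym eq) (trans (cong (_+ x) w≡0) (+-identityˡ x))) (+-mono-≤ 0≤y 0≤z)

cancel-middle : ∀ x y z → ((x + - y) + z) + y ≡ x + z
cancel-middle = solve 3 (λ x y z → ((x :+ :- y) :+ z) :+ y := x :+ z) refl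

cancel-last : ∀ x y z → ((x + y) + - z) + z ≡ x + y
cancel-last = solve 3 (λ x y z → ((x :+ y) :+ :- z) :+ z := x :+ y) refl

swap-last : ∀ x y u v → ((x + - y) + u) + v ≡ ((x + - y) + v) + u
swap-last = solve 4 (λ x y u v → ((x :+ :- y) :+ u) :+ v := ((x :+ :- y) :+ v) :+ u) refl

0<1 : 0ℚ < 1ℚ
0<1 = toWitness {a? = 0ℚ <? 1ℚ} _

*-nonneg : ∀ {x y} → 0ℚ ≤ x → 0ℚ ≤ y → 0ℚ ≤ x * y
*-nonneg {x} {y} 0≤x 0≤y =
  nonNegative⁻¹ (x * y) {{nonNeg*nonNeg⇒nonNeg x {{nonNegative 0≤x}} y {{nonNegative 0≤y}}}}

ℕ→ℚ : ℕ → ℚ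
ℕ→ℚ n = mkℚ (ℤ.+ n) 0 (coprime-sym (1-coprimeTo n))

1+ℕ→ℚ : ∀ n → 1ℚ + ℕ→ℚ n ≡ ℕ→ℚ (ℕ.suc n)
1+ℕ→ℚ n = trans (/-cong (cong (ℤ._+_ 1ℤ) (ℤₚ.*-identityʳ (ℤ.+ n))) refl) (↥p/↧p≡p (ℕ→ℚ (ℕ.suc n)))

∑-const : ∀ n (x : ℚ) → ∑ {n} (λ _ → x) ≡ ℕ→ℚ n * x
∑-const ℕ.zero    x = sym (*-zeroˡ x)
∑-const (ℕ.suc n) x = begin
  x + ∑ {n} (λ _ → x)       ≡⟨ cong₂ _+_ (sym (*-identityˡ x)) (∑-const n x) ⟩
  1ℚ * x + ℕ→ℚ n * x        ≡⟨ *-distribʳ-+ x 1ℚ (ℕ→ℚ n) ⟨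
  (1ℚ + ℕ→ℚ n) * x          ≡⟨ cong (_* x) (1+ℕ→ℚ n) ⟩
  ℕ→ℚ (ℕ.suc n) * x         ∎
  where open ≡-Reasoning

∑-reciprocal : ∀ n .{{_ : NonZero n}} → ∑ {n} (λ _ → 1ℤ / n) ≡ 1ℚ
∑-reciprocal n@(ℕ.suc _) = begin
  ∑ {n} (λ _ → 1ℤ / n)         ≡⟨ ∑-const n (1ℤ / n) ⟩
  ℕ→ℚ n * (1ℤ / n)             ≡⟨ cong (ℕ→ℚ n *_) (↥p/↧p≡p (1/ ℕ→ℚ n)) ⟩
  ℕ→ℚ n * 1/ ℕ→ℚ n             ≡⟨ *-inverseʳ (ℕ→ℚ n) ⟩
  1ℚ                            ∎
  where open ≡-Reasoning

-- Lattice points, affine functionals and q̃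

dot : ∀ {n} → (Fin n → ℚ) → (Fin n → ℚ) → ℚ
dot a x = ∑ (λ k → a k * x k)

dot-indicator : ∀ {n} (a : Fin n → ℚ) j → dot a (λ k → if does (j Fin.≟ k) then 1ℚ else 0ℚ) ≡ a j
dot-indicator {ℕ.suc n} a zero = begin
  a zero * 1ℚ + ∑ (λ k → a (suc k) * 0ℚ)  ≡⟨ cong₂ _+_ (*-identityʳ (a zero)) (∑-cong (*-zeroʳ ∘ a ∘ suc)) ⟩
  a zero + ∑ {n} (λ _ → 0ℚ)                ≡⟨ cong (a zero +_) (trans (∑-const n 0ℚ) (*-zeroʳ (ℕ→ℚ n))) ⟩
  a zero + 0ℚ                              ≡⟨ +-identityʳ (a zero) ⟩
  a zero                                   ∎
  where open ≡-Reasoning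
dot-indicator {ℕ.suc n} a (suc j) =
  trans (cong₂ _+_ (*-zeroʳ (a zero)) (dot-indicator (a ∘ suc) j)) (+-identityˡ (a (suc j)))

module _ {m : ℕ} where

  basis-on : ∀ (j : Fin (2 ℕ.+ m)) → basis j j ≡ 1ℚ
  basis-on j = cong (if_then 1ℚ else 0ℚ) (dec-true (j Fin.≟ j) refl)

  basis-off : ∀ {j k : Fin (2 ℕ.+ m)} → j ≢ k → basis j k ≡ 0ℚ
  basis-off {j} {k} j≢k = cong (if_then 1ℚ else 0ℚ) (dec-false (j Fin.≟ k) j≢k)

  dot-basis : ∀ (a : Pt m) j → dot a (basis j) ≡ a j
  dot-basis = dot-indicator

  dot-⊕ : ∀ (a p q : Pt m) → dot a (p ⊕ q) ≡ dot a p + dot a q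
  dot-⊕ a p q =
    trans (∑-cong λ k → *-distribˡ-+ (a k) (p k) (q k)) (∑-+ (λ k → a k * p k) (λ k → a k * q k))

  dot-⊖ : ∀ (a p q : Pt m) → dot a (p ⊖ q) ≡ dot a p + - dot a q
  dot-⊖ a p q = begin
    dot a (p ⊖ q)                        ≡⟨ ∑-cong (λ k → trans (*-distribˡ-+ (a k) (p k) (- q k))
                                                   (cong (a k * p k +_) (sym (neg-distribʳ-* (a k) (q k))))) ⟩
    ∑ (λ k → a k * p k + - (a k * q k))  ≡⟨ ∑-+ (λ k → a k * p k) (λ k → - (a k * q k)) ⟩
    dot a p + ∑ (λ k → - (a k * q k))    ≡⟨ cong (dot a p +_) (∑-neg (λ k → a k * q k)) ⟩
    dot a p + - dot a q                  ∎
    where open ≡-Reasoning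

  value : Pt m → Var m → ℚ
  value a z₁     = a c₁
  value a z₂     = a c₂
  value a (ze i) = a (cE i)
  value a (tt i) = (a c₁ + a c₂) + - a (cE i)
  value a (yr i) = (a c₁ + - a c₂) + a (cE i)
  value a (yl i) = (a c₂ + - a c₁) + a (cE i)

  dot-point : ∀ (a : Pt m) w → dot a (point w) ≡ value a w
  dot-point a z₁     = dot-basis a c₁
  dot-point a z₂     = dot-basis a c₂
  dot-point a (ze i) = dot-basis a (cE i)
  dot-point a (tt i) =
    trans (dot-⊖ a (basis c₁ ⊕ basis c₂) (basis (cE i)))
          (cong₂ _+_ (trans (dot-⊕ a (basis c₁) (basis c₂)) (cong₂ _+_ (dot-basis a c₁) (dot-basis a c₂)))
                     (cong -_ (dot-basis a (cE i))))
  dot-point a (yr i) =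
    trans (dot-⊕ a (basis c₁ ⊖ basis c₂) (basis (cE i)))
          (cong₂ _+_ (trans (dot-⊖ a (basis c₁) (basis c₂))
                            (cong₂ _+_ (dot-basis a c₁) (cong -_ (dot-basis a c₂))))
                     (dot-basis a (cE i)))
  dot-point a (yl i) =
    trans (dot-⊕ a (basis c₂ ⊖ basis c₁) (basis (cE i)))
          (cong₂ _+_ (trans (dot-⊖ a (basis c₂) (basis c₁))
                            (cong₂ _+_ (dot-basis a c₂) (cong -_ (dot-basis a c₁))))
                     (dot-basis a (cE i)))

  ∑-point : ∀ (w : Var m) → ∑ (point w) ≡ 1ℚ
  ∑-point w =
    trans (∑-cong (λ k → sym (*-identityˡ (point w k)))) (trans (dot-point (λ _ → 1ℚ) w) (value-of-ones w))
    where
    value-of-ones : ∀ w → value (λ _ → 1ℚ) w ≡ 1ℚ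
    value-of-ones z₁     = refl
    value-of-ones z₂     = refl
    value-of-ones (ze _) = refl
    value-of-ones (tt _) = refl
    value-of-ones (yr _) = refl
    value-of-ones (yl _) = refl

  affine≡dot : ∀ (a : Pt m) c {x} → ∑ x ≡ 1ℚ → affine a c x ≡ dot (λ k → a k + c) x
  affine≡dot a c {x} ∑x≡1 = sym (begin
    ∑ (λ k → (a k + c) * x k)           ≡⟨ ∑-cong (λ k → *-distribʳ-+ (x k) (a k) c) ⟩
    ∑ (λ k → a k * x k + c * x k)       ≡⟨ ∑-+ (λ k → a k * x k) (λ k → c * x k) ⟩
    dot a x + ∑ (λ k → c * x k)         ≡⟨ cong (dot a x +_) (∑-*ˡ c x) ⟩
    dot a x + c * ∑ x                   ≡⟨ cong (λ t → dot a x + c * t) ∑x≡1 ⟩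
    dot a x + c * 1ℚ                    ≡⟨ cong (dot a x +_) (*-identityʳ c) ⟩
    affine a c x                        ∎)
    where open ≡-Reasoning

  affine-point : ∀ (a : Pt m) c w → affine a c (point w) ≡ value (λ k → a k + c) w
  affine-point a c w = trans (affine≡dot a c {point w} (∑-point w)) (dot-point (λ k → a k + c) w)

  affine₀-point : ∀ (a : Pt m) w → affine a 0ℚ (point w) ≡ value a w
  affine₀-point a w = trans (+-identityʳ (dot a (point w))) (dot-point a w)

  value-local : ∀ {a b : Pt m} K j → a c₁ ≡ b c₁ → a c₂ ≡ b c₂ → a (cE j) ≡ b (cE j) →
                value a (ev K j) ≡ value b (ev K j)
  value-local kz  _ _   _   eₑ = eₑ
  value-local kt  _ e₁ e₂ eₑ = cong₂ _+_ (cong₂ _+_ e₁ e₂) (cong -_ eₑ)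
  value-local kyr _ e₁ e₂ eₑ = cong₂ _+_ (cong₂ _+_ e₁ (cong -_ e₂)) eₑ
  value-local kyl _ e₁ e₂ eₑ = cong₂ _+_ (cong₂ _+_ e₂ (cong -_ e₁)) eₑ

  dot-neg-basis : ∀ (x : Pt m) j → dot (λ k → - basis j k) x ≡ - x j
  dot-neg-basis x j = begin
    ∑ (λ k → - basis j k * x k)     ≡⟨ ∑-cong (λ k → trans (sym (neg-distribˡ-* (basis j k) (x k)))
                                                           (cong -_ (*-comm (basis j k) (x k)))) ⟩
    ∑ (λ k → - (x k * basis j k))   ≡⟨ ∑-neg (λ k → x k * basis j k) ⟩
    - dot x (basis j)               ≡⟨ cong -_ (dot-basis x j) ⟩
    - x j                           ∎
    where open ≡-Reasoning

  corner : ℚ → ℚ → (Fin m → ℚ) → Pt m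
  corner α β f zero          = α
  corner α β f (suc zero)    = β
  corner α β f (suc (suc j)) = f j

module _ {m : ℕ} .{{_ : NonZero m}} where

  q̃ : Pt m
  q̃ = qt m

  ∑-q̃-edges : ∑ (λ i → q̃ (cE i)) ≡ 1ℤ / 6
  ∑-q̃-edges = begin
    ∑ {m} (λ _ → 1ℤ / m * sixth)    ≡⟨ ∑-cong {m} (λ _ → *-comm (1ℤ / m) sixth) ⟩
    ∑ {m} (λ _ → sixth * (1ℤ / m))  ≡⟨ ∑-*ˡ {m} sixth (λ _ → 1ℤ / m) ⟩
    sixth * ∑ {m} (λ _ → 1ℤ / m)    ≡⟨ cong (sixth *_) (∑-reciprocal m) ⟩
    sixth * 1ℚ                      ≡⟨ *-identityʳ sixth ⟩
    1ℤ / 6                          ∎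
    where
    open ≡-Reasoning
    sixth : ℚ
    sixth = (1ℤ / 2) * (1ℤ / 3)

  ∑-q̃ : ∑ q̃ ≡ 1ℚ
  ∑-q̃ = cong (λ t → q̃ c₁ + (q̃ c₂ + t)) ∑-q̃-edges

  q̃-edge-positive : ∀ i → 0ℚ < q̃ (cE i)
  q̃-edge-positive i =
    positive⁻¹ _ {{pos*pos⇒pos (1ℤ / m) {{normalize-pos 1 m}} _ {{positive sixth-positive}}}}
    where
    sixth-positive : 0ℚ < (1ℤ / 2) * (1ℤ / 3)
    sixth-positive = toWitness {a? = 0ℚ <? (1ℤ / 2) * (1ℤ / 3)} _

  q̃-nonneg : ∀ k → 0ℚ ≤ q̃ k
  q̃-nonneg zero          = toWitness {a? = 0ℚ ≤? q̃ c₁} _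
  q̃-nonneg (suc zero)    = toWitness {a? = 0ℚ ≤? q̃ c₂} _
  q̃-nonneg (suc (suc i)) = <⇒≤ (q̃-edge-positive i)

kindEq-sound : ∀ k l → T (kindEq k l) → k ≡ l
kindEq-sound kz  kz  _ = refl
kindEq-sound kt  kt  _ = refl
kindEq-sound kyr kyr _ = refl
kindEq-sound kyl kyl _ = refl

kindEq-refl : ∀ k → T (kindEq k k)
kindEq-refl kz  = _
kindEq-refl kt  = _
kindEq-refl kyr = _
kindEq-refl kyl = _

module _ {m : ℕ} where

  varEq-sound : ∀ (x y : Var m) → T (varEq x y) → x ≡ y
  varEq-sound z₁ z₁ _ = refl
  varEq-sound z₂ z₂ _ = refl
  varEq-sound (ev k i) (ev l j) _ with kindEq k l in k≈l | i Fin.≟ j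
  ... | true | yes refl = cong (λ k → ev k i) (kindEq-sound k l (subst T (sym k≈l) _))

  varEq-refl : ∀ (x : Var m) → T (varEq x x)
  varEq-refl z₁ = _
  varEq-refl z₂ = _
  varEq-refl (ev k i) with kindEq k k | kindEq-refl k | i Fin.≟ i
  ... | true | _ | yes _  = _
  ... | true | _ | no i≢i = i≢i refl

  _≟ᵛ_ : DecidableEquality (Var m)
  x ≟ᵛ y = map′ (varEq-sound x y) (λ { refl → varEq-refl x }) (T? (varEq x y))

-- rank places z₂ < z₁ below four blocks of m consecutive values, for t, z_e, ←y and →y in turn.
band : Kind → ℕ
band kt  = 0
band kz  = 1
band kyl = 2
band kyr = 3

<-by-band : ∀ {m a b x y} → a ℕ.< b → x ℕ.< m → a ℕ.* m ℕ.+ x ℕ.< b ℕ.* m ℕ.+ y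
<-by-band {m} {a} {b} {x} {y} a<b x<m = begin-strict
  a ℕ.* m ℕ.+ x  <⟨ ℕₚ.+-monoʳ-< (a ℕ.* m) x<m ⟩
  a ℕ.* m ℕ.+ m  ≡⟨ ℕₚ.+-comm (a ℕ.* m) m ⟩
  ℕ.suc a ℕ.* m  ≤⟨ ℕₚ.*-monoˡ-≤ m a<b ⟩
  b ℕ.* m        ≤⟨ ℕₚ.m≤m+n (b ℕ.* m) y ⟩
  b ℕ.* m ℕ.+ y  ∎
  where open ℕₚ.≤-Reasoning

record _≺_ {m : ℕ} (x y : Var m) : Set where
  constructor rank<
  field rank-< : rank x ℕ.< rank y
open _≺_

module _ {m : ℕ} where

  offset : Kind → Fin m → ℕ
  offset kyl i = toℕ i
  offset _   i = toℕ (Fin.opposite i)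

  rank-ev : ∀ K (i : Fin m) → rank (ev K i) ≡ 2 ℕ.+ (band K ℕ.* m ℕ.+ offset K i)
  rank-ev kt  i = cong (2 ℕ.+_) (sym (opposite-prop i))
  rank-ev kz  i = cong₂ (λ s t → 2 ℕ.+ (s ℕ.+ t)) (sym (ℕₚ.+-identityʳ m)) (sym (opposite-prop i))
  rank-ev kyl i = refl
  rank-ev kyr i = cong (λ t → 2 ℕ.+ (3 ℕ.* m ℕ.+ t)) (sym (opposite-prop i))

  offset<m : ∀ K (i : Fin m) → offset K i ℕ.< m
  offset<m kyl i = toℕ<n i
  offset<m kt  i = toℕ<n (Fin.opposite i)
  offset<m kz  i = toℕ<n (Fin.opposite i)
  offset<m kyr i = toℕ<n (Fin.opposite i)

  ev≺ev : ∀ {K L} {i j : Fin m} {_ : True (band K ℕ.<? band L)} → ev K i ≺ ev L j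
  ev≺ev {K} {L} {i} {j} {K<L} = rank< (subst₂ ℕ._<_ (sym (rank-ev K i)) (sym (rank-ev L j))
    (s≤s (s≤s (<-by-band (toWitness K<L) (offset<m K i)))))

  z₁≺ev : ∀ {K} {i : Fin m} → z₁ ≺ ev K i
  z₁≺ev {K} {i} = rank< (subst (1 ℕ.<_) (sym (rank-ev K i)) (s≤s (s≤s z≤n)))

  z₂≺ev : ∀ {K} {i : Fin m} → z₂ ≺ ev K i
  z₂≺ev {K} {i} = rank< (subst (0 ℕ.<_) (sym (rank-ev K i)) (s≤s z≤n))

  yr≺yr : ∀ {i k : Fin m} → toℕ i ℕ.< toℕ k → yr k ≺ yr i
  yr≺yr {i} {k} i<k = rank< (ℕₚ.+-monoʳ-< (2 ℕ.+ 3 ℕ.* m) (ℕₚ.∸-monoʳ-< (s≤s i<k) (toℕ<n k)))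

  yl≺yl : ∀ {i k : Fin m} → toℕ k ℕ.< toℕ i → yl k ≺ yl i
  yl≺yl k<i = rank< (ℕₚ.+-monoʳ-< (2 ℕ.+ 2 ℕ.* m) k<i)

  expo-∉ : ∀ (N : Mon m) y → y ∉ N → expo N y ≡ 0
  expo-∉ [] _ _ = refl
  expo-∉ (w ∷ N) y y∉ with varEq y w in y≈w
  ... | true  = contradiction (here (varEq-sound y w (subst T (sym y≈w) _))) y∉
  ... | false = expo-∉ N y (y∉ ∘ there)

  expo-∈ : ∀ (M : Mon m) x → x ∈ M → 0 ℕ.< expo M x
  expo-∈ (w ∷ M) x x∈ with varEq x w in x≈w
  ... | true = s≤s z≤n
  expo-∈ (w ∷ M) x (here refl) | false = contradiction (subst T x≈w (varEq-refl w)) λ ()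
  expo-∈ (w ∷ M) x (there x∈)  | false = expo-∈ M x x∈

  below⇒∉ : ∀ {N : Mon m} y → All (λ w → rank w ℕ.< rank y) N → y ∉ N
  below⇒∉ y N<y y∈N = ℕₚ.<-irrefl refl (All.lookup N<y y∈N)

  leading : ∀ {x : Var m} {M N : Mon m} → x ∈ M →
            All (λ w → rank w ℕ.≤ rank x) M → All (λ w → rank w ℕ.< rank x) N → N <lex M
  leading {x} {M} {N} x∈M M≤x N<x = x , expo-N<expo-M , agree-above
    where
    expo-N<expo-M : expo N x ℕ.< expo M x
    expo-N<expo-M = subst (ℕ._< expo M x) (sym (expo-∉ N x (below⇒∉ x N<x))) (expo-∈ M x x∈M)

    agree-above : ∀ y → rank x ℕ.< rank y → expo M y ≡ expo N y
    agree-above y x<y = trans (expo-∉ M y (below⇒∉ y (All.map (λ w≤x → ℕₚ.≤-<-trans w≤x x<y) M≤x)))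
                              (sym (expo-∉ N y (below⇒∉ y (All.map (λ w<x → ℕₚ.<-trans w<x x<y) N<x))))

  head-leads : ∀ {x x′ y y′ : Var m} → x′ ≺ x → y ≺ x → y′ ≺ x → (y ∷ y′ ∷ []) <lex (x ∷ x′ ∷ [])
  head-leads x′≺x y≺x y′≺x =
    leading (here refl) (ℕₚ.≤-refl ∷ ℕₚ.<⇒≤ (rank-< x′≺x) ∷ []) (rank-< y≺x ∷ rank-< y′≺x ∷ [])

  last-leads : ∀ {x x′ y y′ : Var m} → x ≺ x′ → y ≺ x′ → y′ ≺ x′ → (y ∷ y′ ∷ []) <lex (x ∷ x′ ∷ [])
  last-leads x≺x′ y≺x′ y′≺x′ =
    leading (there (here refl)) (ℕₚ.<⇒≤ (rank-< x≺x′) ∷ ℕₚ.≤-refl ∷ []) (rank-< y≺x′ ∷ rank-< y′≺x′ ∷ [])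

-- Facets of 𝒯_m

module Facet {m : ℕ} {S : Mon m} (facet : IsFacet m S) where

  open DecMembership (_≟ᵛ_ {m}) using (_∈?_)

  S-unique : Unique S
  S-unique = proj₁ facet

  S-length : length S ≡ 2 ℕ.+ m
  S-length = proj₁ (proj₂ facet)

  no-leading : ∀ b → proj₂ (terms b) <lex proj₁ (terms b) → ¬ All (_∈ S) (proj₁ (terms b))
  no-leading b lt u⊆S = proj₂ (proj₂ facet) b (inj₁ (lt , u⊆S))

  yr∈⇒yl∉ : ∀ {i k} → yr i ∈ S → yl k ∉ S
  yr∈⇒yl∉ {i} {k} yr∈ yl∈ with i Fin.≟ k
  ... | yes refl = no-leading (b1 i) (head-leads ev≺ev ev≺ev ev≺ev) (yr∈ ∷ yl∈ ∷ [])
  ... | no i≢k   = no-leading (b7 i k i≢k) (head-leads ev≺ev ev≺ev ev≺ev) (yr∈ ∷ yl∈ ∷ [])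

  yr∈⇒tt∉ : ∀ {i} → yr i ∈ S → tt i ∉ S
  yr∈⇒tt∉ {i} yr∈ tt∈ = no-leading (b2 i) (head-leads ev≺ev z₁≺ev z₁≺ev) (yr∈ ∷ tt∈ ∷ [])

  yl∈⇒tt∉ : ∀ {i} → yl i ∈ S → tt i ∉ S
  yl∈⇒tt∉ {i} yl∈ tt∈ = no-leading (b3 i) (head-leads ev≺ev z₂≺ev z₂≺ev) (yl∈ ∷ tt∈ ∷ [])

  yr∈⇒z₂∉ : ∀ {i} → yr i ∈ S → z₂ ∉ S
  yr∈⇒z₂∉ {i} yr∈ z₂∈ = no-leading (b4 i) (head-leads z₂≺ev z₁≺ev ev≺ev) (yr∈ ∷ z₂∈ ∷ [])

  yl∈⇒z₁∉ : ∀ {i} → yl i ∈ S → z₁ ∉ S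
  yl∈⇒z₁∉ {i} yl∈ z₁∈ = no-leading (b5 i) (head-leads z₁≺ev z₂≺ev ev≺ev) (yl∈ ∷ z₁∈ ∷ [])

  tt∈⇒ze∉ : ∀ {i} → tt i ∈ S → ze i ∉ S
  tt∈⇒ze∉ {i} tt∈ ze∈ = no-leading (b6 i) (last-leads ev≺ev z₁≺ev z₂≺ev) (tt∈ ∷ ze∈ ∷ [])

  yr∈⇒ze∉ : ∀ {i k} → toℕ i ℕ.< toℕ k → yr i ∈ S → ze k ∉ S
  yr∈⇒ze∉ {i} {k} i<k yr∈ ze∈ =
    no-leading (b8 i k (λ { refl → ℕₚ.<-irrefl refl i<k }))
      (head-leads ev≺ev (yr≺yr i<k) ev≺ev) (yr∈ ∷ ze∈ ∷ [])

  yl∈⇒ze∉ : ∀ {i k} → toℕ k ℕ.< toℕ i → yl i ∈ S → ze k ∉ S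
  yl∈⇒ze∉ {i} {k} k<i yl∈ ze∈ =
    no-leading (b9 i k (λ { refl → ℕₚ.<-irrefl refl k<i }))
      (head-leads ev≺ev (yl≺yl k<i) ev≺ev) (yl∈ ∷ ze∈ ∷ [])

  RightDouble LeftDouble : Fin m → Set
  RightDouble i = yr i ∈ S × ze i ∈ S
  LeftDouble  i = yl i ∈ S × ze i ∈ S

  rightDouble-unique : ∀ {a b} → RightDouble a → RightDouble b → a ≡ b
  rightDouble-unique {a} {b} (yr-a , ze-a) (yr-b , ze-b) with ℕₚ.<-cmp (toℕ a) (toℕ b)
  ... | tri< a<b _ _ = contradiction ze-b (yr∈⇒ze∉ a<b yr-a)
  ... | tri≈ _ a≡b _ = toℕ-injective a≡b
  ... | tri> _ _ b<a = contradiction ze-a (yr∈⇒ze∉ b<a yr-b)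

  leftDouble-unique : ∀ {a b} → LeftDouble a → LeftDouble b → a ≡ b
  leftDouble-unique {a} {b} (yl-a , ze-a) (yl-b , ze-b) with ℕₚ.<-cmp (toℕ a) (toℕ b)
  ... | tri< a<b _ _ = contradiction ze-a (yl∈⇒ze∉ a<b yl-b)
  ... | tri≈ _ a≡b _ = toℕ-injective a≡b
  ... | tri> _ _ b<a = contradiction ze-b (yl∈⇒ze∉ b<a yl-a)

  edge-pair : ∀ {K L i} → K ≢ L → ev K i ∈ S → ev L i ∈ S →
              (K ≡ kz ⊎ L ≡ kz) × (RightDouble i ⊎ LeftDouble i)
  edge-pair {kz}  {kz}  K≢L _ _ = contradiction refl K≢L
  edge-pair {kt}  {kt}  K≢L _ _ = contradiction refl K≢L
  edge-pair {kyr} {kyr} K≢L _ _ = contradiction refl K≢L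
  edge-pair {kyl} {kyl} K≢L _ _ = contradiction refl K≢L
  edge-pair {kz}  {kyr} _ p q = inj₁ refl , inj₁ (q , p)
  edge-pair {kz}  {kyl} _ p q = inj₁ refl , inj₂ (q , p)
  edge-pair {kyr} {kz}  _ p q = inj₂ refl , inj₁ (p , q)
  edge-pair {kyl} {kz}  _ p q = inj₂ refl , inj₂ (p , q)
  edge-pair {kz}  {kt}  _ p q = contradiction p (tt∈⇒ze∉ q)
  edge-pair {kt}  {kz}  _ p q = contradiction q (tt∈⇒ze∉ p)
  edge-pair {kt}  {kyr} _ p q = contradiction p (yr∈⇒tt∉ q)
  edge-pair {kyr} {kt}  _ p q = contradiction q (yr∈⇒tt∉ p)
  edge-pair {kt}  {kyl} _ p q = contradiction p (yl∈⇒tt∉ q)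
  edge-pair {kyl} {kt}  _ p q = contradiction q (yl∈⇒tt∉ p)
  edge-pair {kyr} {kyl} _ p q = contradiction q (yr∈⇒yl∉ p)
  edge-pair {kyl} {kyr} _ p q = contradiction p (yr∈⇒yl∉ q)

  squiggly-alone : ∀ {i K} → tt i ∈ S → ev K i ∈ S → K ≡ kt
  squiggly-alone {K = kt}  _   _   = refl
  squiggly-alone {K = kz}  tt∈ ze∈ = contradiction ze∈ (tt∈⇒ze∉ tt∈)
  squiggly-alone {K = kyr} tt∈ yr∈ = contradiction tt∈ (yr∈⇒tt∉ yr∈)
  squiggly-alone {K = kyl} tt∈ yl∈ = contradiction tt∈ (yl∈⇒tt∉ yl∈)

  ze-slot : ∀ i → Dec (yr i ∈ S) → Dec (yl i ∈ S) → Fin (2 ℕ.+ m)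
  ze-slot i (yes _) _       = c₂
  ze-slot i (no _)  (yes _) = c₁
  ze-slot i (no _)  (no _)  = cE i

  -- The z_e of a double edge takes the coordinate of the z that its y excludes.
  slot : Var m → Fin (2 ℕ.+ m)
  slot z₁     = c₁
  slot z₂     = c₂
  slot (ze i) = ze-slot i (yr i ∈? S) (yl i ∈? S)
  slot (tt i) = cE i
  slot (yr i) = cE i
  slot (yl i) = cE i

  slot≡c₁ : ∀ x → slot x ≡ c₁ → x ≡ z₁ ⊎ ∃[ a ] x ≡ ze a × yl a ∈ S
  slot≡c₁ z₁ _ = inj₁ refl
  slot≡c₁ (ze a) eq with yr a ∈? S | yl a ∈? S
  slot≡c₁ (ze a) () | yes _ | _
  slot≡c₁ (ze a) _  | no _  | yes yl∈ = inj₂ (a , refl , yl∈)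
  slot≡c₁ (ze a) () | no _  | no _
  slot≡c₁ z₂     ()
  slot≡c₁ (tt _) ()
  slot≡c₁ (yr _) ()
  slot≡c₁ (yl _) ()

  slot≡c₂ : ∀ x → slot x ≡ c₂ → x ≡ z₂ ⊎ ∃[ a ] x ≡ ze a × yr a ∈ S
  slot≡c₂ z₂ _ = inj₁ refl
  slot≡c₂ (ze a) eq with yr a ∈? S | yl a ∈? S
  slot≡c₂ (ze a) _  | yes yr∈ | _ = inj₂ (a , refl , yr∈)
  slot≡c₂ (ze a) () | no _    | yes _
  slot≡c₂ (ze a) () | no _    | no _
  slot≡c₂ z₁     ()
  slot≡c₂ (tt _) ()
  slot≡c₂ (yr _) ()
  slot≡c₂ (yl _) ()

  slot≡cE : ∀ x {j} → slot x ≡ cE j → ∃[ K ] x ≡ ev K j × (K ≡ kz → ¬ (RightDouble j ⊎ LeftDouble j))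
  slot≡cE (ze a) eq with yr a ∈? S | yl a ∈? S
  slot≡cE (ze a) ()   | yes _   | _
  slot≡cE (ze a) ()   | no _    | yes _
  slot≡cE (ze a) refl | no yr∉ | no yl∉ = kz , refl , λ _ → λ where
    (inj₁ (yr∈ , _)) → yr∉ yr∈
    (inj₂ (yl∈ , _)) → yl∉ yl∈
  slot≡cE (tt a) refl = kt  , refl , λ ()
  slot≡cE (yr a) refl = kyr , refl , λ ()
  slot≡cE (yl a) refl = kyl , refl , λ ()
  slot≡cE z₁ ()
  slot≡cE z₂ ()

  slot-fibre-singleton : ∀ {x y} k → x ∈ S → y ∈ S → slot x ≡ k → slot y ≡ k → x ≡ y
  slot-fibre-singleton {x} {y} zero x∈ y∈ x↦ y↦ with slot≡c₁ x x↦ | slot≡c₁ y y↦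
  ... | inj₁ refl              | inj₁ refl              = refl
  ... | inj₁ refl              | inj₂ (_ , refl , yl∈)  = contradiction x∈ (yl∈⇒z₁∉ yl∈)
  ... | inj₂ (_ , refl , yl∈)  | inj₁ refl              = contradiction y∈ (yl∈⇒z₁∉ yl∈)
  ... | inj₂ (_ , refl , yl-a) | inj₂ (_ , refl , yl-b) =
    cong ze (leftDouble-unique (yl-a , x∈) (yl-b , y∈))
  slot-fibre-singleton {x} {y} (suc zero) x∈ y∈ x↦ y↦ with slot≡c₂ x x↦ | slot≡c₂ y y↦
  ... | inj₁ refl              | inj₁ refl              = refl
  ... | inj₁ refl              | inj₂ (_ , refl , yr∈)  = contradiction x∈ (yr∈⇒z₂∉ yr∈)
  ... | inj₂ (_ , refl , yr∈)  | inj₁ refl              = contradiction y∈ (yr∈⇒z₂∉ yr∈)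
  ... | inj₂ (_ , refl , yr-a) | inj₂ (_ , refl , yr-b) =
    cong ze (rightDouble-unique (yr-a , x∈) (yr-b , y∈))
  slot-fibre-singleton {x} {y} (suc (suc j)) x∈ y∈ x↦ y↦ with x ≟ᵛ y
  ... | yes x≡y = x≡y
  ... | no x≢y with slot≡cE x x↦ | slot≡cE y y↦
  ...   | K , refl , x-alone | L , refl , y-alone
        with edge-pair (λ { refl → x≢y refl }) x∈ y∈
  ...     | inj₁ refl , double = contradiction double (x-alone refl)
  ...     | inj₂ refl , double = contradiction double (y-alone refl)

  slot-surjective : ∀ k → ∃[ x ] x ∈ S × slot x ≡ k
  slot-surjective = injectiveOn⇒surjective S-unique (ℕₚ.≤-reflexive (sym S-length))
    λ x∈ y∈ eq → slot-fibre-singleton _ x∈ y∈ eq refl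

  z₁∈⊎leftDouble : z₁ ∈ S ⊎ ∃[ a ] LeftDouble a
  z₁∈⊎leftDouble with x , x∈ , x↦ ← slot-surjective c₁ with slot≡c₁ x x↦
  ... | inj₁ refl             = inj₁ x∈
  ... | inj₂ (a , refl , yl∈) = inj₂ (a , yl∈ , x∈)

  z₂∈⊎rightDouble : z₂ ∈ S ⊎ ∃[ a ] RightDouble a
  z₂∈⊎rightDouble with x , x∈ , x↦ ← slot-surjective c₂ with slot≡c₂ x x↦
  ... | inj₁ refl             = inj₁ x∈
  ... | inj₂ (a , refl , yr∈) = inj₂ (a , yr∈ , x∈)

  edge-meets : ∀ j → ∃[ K ] ev K j ∈ S
  edge-meets j with x , x∈ , x↦ ← slot-surjective (cE j) with slot≡cE x x↦
  ... | K , refl , _ = K , x∈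

  rightDouble⇒z₁∈ : ∀ {a} → RightDouble a → z₁ ∈ S
  rightDouble⇒z₁∈ (yr∈ , _) with z₁∈⊎leftDouble
  ... | inj₁ z₁∈           = z₁∈
  ... | inj₂ (_ , yl∈ , _) = contradiction yl∈ (yr∈⇒yl∉ yr∈)

  leftDouble⇒z₂∈ : ∀ {a} → LeftDouble a → z₂ ∈ S
  leftDouble⇒z₂∈ (yl∈ , _) with z₂∈⊎rightDouble
  ... | inj₁ z₂∈           = z₂∈
  ... | inj₂ (_ , yr∈ , _) = contradiction yl∈ (yr∈⇒yl∉ yr∈)

  edge-vars : Fin m → List (Var m)
  edge-vars i = filter (T? ∘ inEdge i) S

  ∈edge-vars⁺ : ∀ {K i} → ev K i ∈ S → ev K i ∈ edge-vars i
  ∈edge-vars⁺ {i = i} ev∈ = ∈-filter⁺ (T? ∘ inEdge i) ev∈ (subst T (sym (dec-true (i Fin.≟ i) refl)) _)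

  ∈edge-vars⁻ : ∀ {x i} → x ∈ edge-vars i → ∃[ K ] x ≡ ev K i × x ∈ S
  ∈edge-vars⁻ {x} {i} x∈ = decode x (∈-filter⁻ (T? ∘ inEdge i) {xs = S} x∈)
    where
    decode : ∀ x → x ∈ S × T (inEdge i x) → ∃[ K ] x ≡ ev K i × x ∈ S
    decode (ev K j) (x∈S , in-i) with i Fin.≟ j
    ... | yes refl = K , refl , x∈S

  edge-vars-unique : ∀ i → Unique (edge-vars i)
  edge-vars-unique i = filter⁺ (T? ∘ inEdge i) S-unique

  double-by-partners : ∀ {Y i} → ev Y i ∈ S → ze i ∈ S → Y ≢ kz →
                       (∀ {K} → ev K i ∈ S → K ≡ Y ⊎ K ≡ kz) → Double S i
  double-by-partners {Y} {i} Y∈ ze∈ Y≢kz only-Y-ze =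
    trans (countB≡length∘filter (inEdge i) S)
          (Unique⇒length≡2 (edge-vars-unique i) (λ { refl → Y≢kz refl })
                           (∈edge-vars⁺ Y∈) (∈edge-vars⁺ ze∈) only)
    where
    only : ∀ {x} → x ∈ edge-vars i → x ≡ ev Y i ⊎ x ≡ ze i
    only x∈ with K , refl , K∈ ← ∈edge-vars⁻ x∈ with only-Y-ze K∈
    ... | inj₁ refl = inj₁ refl
    ... | inj₂ refl = inj₂ refl

  rightDouble-partners : ∀ {i} → RightDouble i → ∀ {K} → ev K i ∈ S → K ≡ kyr ⊎ K ≡ kz
  rightDouble-partners _          {kyr} _   = inj₁ refl
  rightDouble-partners _          {kz}  _   = inj₂ refl
  rightDouble-partners (yr∈ , _)  {kt}  tt∈ = contradiction tt∈ (yr∈⇒tt∉ yr∈)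
  rightDouble-partners (yr∈ , _)  {kyl} yl∈ = contradiction yl∈ (yr∈⇒yl∉ yr∈)

  leftDouble-partners : ∀ {i} → LeftDouble i → ∀ {K} → ev K i ∈ S → K ≡ kyl ⊎ K ≡ kz
  leftDouble-partners _          {kyl} _   = inj₁ refl
  leftDouble-partners _          {kz}  _   = inj₂ refl
  leftDouble-partners (yl∈ , _)  {kt}  tt∈ = contradiction tt∈ (yl∈⇒tt∉ yl∈)
  leftDouble-partners (yl∈ , _)  {kyr} yr∈ = contradiction yl∈ (yr∈⇒yl∉ yr∈)

  Double⇔ : ∀ {i} → Double S i ⇔ (RightDouble i ⊎ LeftDouble i)
  Double⇔ {i} = mk⇔ to from
    where
    to : Double S i → RightDouble i ⊎ LeftDouble i
    to double
      with a , b , a≢b , a∈ , b∈ ← length≡2⇒two-elements (edge-vars-unique i)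
                                     (trans (sym (countB≡length∘filter (inEdge i) S)) double)
      with ∈edge-vars⁻ a∈ | ∈edge-vars⁻ b∈
    ... | _ , refl , K∈ | _ , refl , L∈ = proj₂ (edge-pair (λ { refl → a≢b refl }) K∈ L∈)

    from : RightDouble i ⊎ LeftDouble i → Double S i
    from (inj₁ d@(yr∈ , ze∈)) = double-by-partners yr∈ ze∈ (λ ()) (rightDouble-partners d)
    from (inj₂ d@(yl∈ , ze∈)) = double-by-partners yl∈ ze∈ (λ ()) (leftDouble-partners d)

  -- Visibility from q̃

  data Visible : Var m → Set where
    squiggly : ∀ {i} → Visible (tt i)
    right    : ∀ {i} → ze i ∈ S → Visible (yr i)
    left     : ∀ {i} → ze i ∈ S → Visible (yl i)

  visible? : ∀ v → Dec (Visible v)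
  visible? z₁     = no λ ()
  visible? z₂     = no λ ()
  visible? (ze _) = no λ ()
  visible? (tt _) = yes squiggly
  visible? (yr i) = map′ right (λ { (right ze∈) → ze∈ }) (ze i ∈? S)
  visible? (yl i) = map′ left  (λ { (left ze∈) → ze∈ }) (ze i ∈? S)

  module _ (B : Pt m) (nonneg : ∀ {w} → w ∈ S → 0ℚ ≤ value B w)
           (vanish : ∀ {w} → w ∈ S → Visible w → value B w ≡ 0ℚ) where

    coordinate₁-nonneg : 0ℚ ≤ B c₁
    coordinate₁-nonneg with z₁∈⊎leftDouble
    ... | inj₁ z₁∈ = nonneg z₁∈
    ... | inj₂ (a , d@(yl∈ , ze∈)) =
      balance (cancel-middle (B c₂) (B c₁) (B (cE a))) (vanish yl∈ (left ze∈))
              (nonneg (leftDouble⇒z₂∈ d)) (nonneg ze∈)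

    coordinate₂-nonneg : 0ℚ ≤ B c₂
    coordinate₂-nonneg with z₂∈⊎rightDouble
    ... | inj₁ z₂∈ = nonneg z₂∈
    ... | inj₂ (a , d@(yr∈ , ze∈)) =
      balance (cancel-middle (B c₁) (B c₂) (B (cE a))) (vanish yr∈ (right ze∈))
              (nonneg (rightDouble⇒z₁∈ d)) (nonneg ze∈)

    coordinateₑ-nonneg : ∀ j → 0ℚ ≤ B (cE j)
    coordinateₑ-nonneg j with edge-meets j
    ... | kz , ze∈ = nonneg ze∈
    ... | kt , tt∈ =
      balance (cancel-last (B c₁) (B c₂) (B (cE j))) (vanish tt∈ squiggly)
              coordinate₁-nonneg coordinate₂-nonneg
    ... | kyr , yr∈ with z₂∈⊎rightDouble
    ...   | inj₁ z₂∈ = contradiction z₂∈ (yr∈⇒z₂∉ yr∈)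
    ...   | inj₂ (a , yr-a , ze-a) =
      balance (swap-last (B c₁) (B c₂) (B (cE a)) (B (cE j))) (vanish yr-a (right ze-a))
              (nonneg yr∈) (nonneg ze-a)
    coordinateₑ-nonneg j | kyl , yl∈ with z₁∈⊎leftDouble
    ...   | inj₁ z₁∈ = contradiction z₁∈ (yl∈⇒z₁∉ yl∈)
    ...   | inj₂ (a , yl-a , ze-a) =
      balance (swap-last (B c₂) (B c₁) (B (cE a)) (B (cE j))) (vanish yl-a (left ze-a))
              (nonneg yl∈) (nonneg ze-a)

    coordinates-nonneg : ∀ k → 0ℚ ≤ B k
    coordinates-nonneg zero          = coordinate₁-nonneg
    coordinates-nonneg (suc zero)    = coordinate₂-nonneg
    coordinates-nonneg (suc (suc j)) = coordinateₑ-nonneg j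

  missing-ze : Fin m → ℚ
  missing-ze b = if does (ze b ∈? S) then 0ℚ else - 1ℚ

  missing-ze-∈ : ∀ {b} → ze b ∈ S → missing-ze b ≡ 0ℚ
  missing-ze-∈ {b} ze∈ = cong (if_then 0ℚ else - 1ℚ) (dec-true (ze b ∈? S) ze∈)

  missing-ze-∉ : ∀ {b} → ze b ∉ S → missing-ze b ≡ - 1ℚ
  missing-ze-∉ {b} ze∉ = cong (if_then 0ℚ else - 1ℚ) (dec-false (ze b ∈? S) ze∉)

  missing-ze≤0 : ∀ b → missing-ze b ≤ 0ℚ
  missing-ze≤0 b with ze b ∈? S
  ... | yes _ = ≤-refl
  ... | no _  = toWitness {a? = - 1ℚ ≤? 0ℚ} _

  module _ .{{_ : NonZero m}} where

    VisibleFacet⇒Visible : ∀ {v} → v ∈ S → VisibleFacet q̃ S v → Visible v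
    VisibleFacet⇒Visible {v} v∈ (a , c , vanish-off-v , v-positive , q̃-negative) with visible? v
    ... | yes visible  = visible
    ... | no invisible = contradiction (<-≤-trans q̃-negative 0≤q̃-value) (<-irrefl refl)
      where
      B : Pt m
      B k = a k + c

      nonneg : ∀ {w} → w ∈ S → 0ℚ ≤ value B w
      nonneg {w} w∈ with w ≟ᵛ v
      ... | yes refl = <⇒≤ (subst (0ℚ <_) (affine-point a c v) v-positive)
      ... | no w≢v   = ≤-reflexive (sym (trans (sym (affine-point a c w)) (vanish-off-v w w∈ w≢v)))

      vanish : ∀ {w} → w ∈ S → Visible w → value B w ≡ 0ℚ
      vanish {w} w∈ visible =
        trans (sym (affine-point a c w)) (vanish-off-v w w∈ λ { refl → invisible visible })

      0≤q̃-value : 0ℚ ≤ affine a c q̃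
      0≤q̃-value = subst (0ℚ ≤_) (sym (affine≡dot a c {q̃} ∑-q̃))
                    (∑-nonneg λ k → *-nonneg (coordinates-nonneg B nonneg vanish k) (q̃-nonneg k))

    visible-tt : ∀ {i} → tt i ∈ S → VisibleFacet q̃ S (tt i)
    visible-tt {i} tt∈ = a , 0ℚ , vanish , v-positive , q̃-negative
      where
      a : Pt m
      a k = - basis (cE i) k

      value-vanish : ∀ w → w ∈ S → w ≢ tt i → value a w ≡ 0ℚ
      value-vanish z₁ _ _ = refl
      value-vanish z₂ _ _ = refl
      value-vanish (ev K j) w∈ w≢tt with j Fin.≟ i
      ... | yes refl = contradiction (cong (λ K → ev K i) (squiggly-alone tt∈ w∈)) w≢tt
      ... | no j≢i   = trans (value-local {b = λ _ → 0ℚ} K j refl refl a-at-j) (value-of-zero K)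
        where
        a-at-j : a (cE j) ≡ 0ℚ
        a-at-j = cong -_ (basis-off {j = cE i} {cE j} λ { refl → j≢i refl })

        value-of-zero : ∀ K → value (λ _ → 0ℚ) (ev K j) ≡ 0ℚ
        value-of-zero kz  = refl
        value-of-zero kt  = refl
        value-of-zero kyr = refl
        value-of-zero kyl = refl

      vanish : ∀ w → w ∈ S → w ≢ tt i → affine a 0ℚ (point w) ≡ 0ℚ
      vanish w w∈ w≢tt = trans (affine₀-point a w) (value-vanish w w∈ w≢tt)

      value-at-tt : value a (tt i) ≡ 1ℚ
      value-at-tt = cong (λ t → (a c₁ + a c₂) + - - t) (basis-on (cE i))

      v-positive : 0ℚ < affine a 0ℚ (point (tt i))
      v-positive = subst (0ℚ <_) (sym (trans (affine₀-point a (tt i)) value-at-tt)) 0<1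

      q̃-negative : affine a 0ℚ q̃ < 0ℚ
      q̃-negative = subst (_< 0ℚ) (sym (trans (+-identityʳ (dot a q̃)) (dot-neg-basis q̃ (cE i))))
                     (neg-antimono-< (q̃-edge-positive i))

    missing-ze-total : ℚ
    missing-ze-total = ∑ (λ b → missing-ze b * q̃ (cE b))

    missing-ze-total≤0 : missing-ze-total ≤ 0ℚ
    missing-ze-total≤0 = ∑-nonpos λ b →
      subst (missing-ze b * q̃ (cE b) ≤_) (*-zeroˡ (q̃ (cE b)))
        (*-monoʳ-≤-nonNeg (q̃ (cE b)) {{nonNegative (q̃-nonneg (cE b))}} (missing-ze≤0 b))

    z-penalty : - 1ℚ * q̃ c₁ + missing-ze-total < 0ℚ
    z-penalty = +-mono-<-≤ (toWitness {a? = - 1ℚ * q̃ c₁ <? 0ℚ} _) missing-ze-total≤0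

    -- The functional is −x₂ − Σ { x_{e_b} | z_{e_b} ∉ S }: the vertices t_b and →y_b (b ≠ i) of S
    -- lie on its zero set because their z_{e_b} is not in S.
    visible-yr : ∀ {i} → RightDouble i → VisibleFacet q̃ S (yr i)
    visible-yr {i} (yr∈ , ze∈) = a , 0ℚ , vanish , v-positive , q̃-negative
      where
      a : Pt m
      a = corner 0ℚ (- 1ℚ) missing-ze

      off-ze : ∀ K {b} → ze b ∉ S → value a (ev K b) ≡ value (corner 0ℚ (- 1ℚ) (λ _ → - 1ℚ)) (ev K b)
      off-ze K {b} ze∉ = value-local K b refl refl (missing-ze-∉ ze∉)

      value-vanish : ∀ w → w ∈ S → w ≢ yr i → value a w ≡ 0ℚ
      value-vanish z₁     _    _    = refl
      value-vanish z₂     z₂∈  _    = contradiction z₂∈ (yr∈⇒z₂∉ yr∈)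
      value-vanish (ze b) ze-b _    = missing-ze-∈ ze-b
      value-vanish (tt b) tt-b _    = off-ze kt (tt∈⇒ze∉ tt-b)
      value-vanish (yr b) yr-b w≢yr =
        off-ze kyr λ ze-b → w≢yr (cong yr (rightDouble-unique (yr-b , ze-b) (yr∈ , ze∈)))
      value-vanish (yl b) yl-b _    = contradiction yl-b (yr∈⇒yl∉ yr∈)

      vanish : ∀ w → w ∈ S → w ≢ yr i → affine a 0ℚ (point w) ≡ 0ℚ
      vanish w w∈ w≢yr = trans (affine₀-point a w) (value-vanish w w∈ w≢yr)

      value-at-yr : value a (yr i) ≡ 1ℚ
      value-at-yr = value-local {a = a} {corner 0ℚ (- 1ℚ) (λ _ → 0ℚ)} kyr i refl refl (missing-ze-∈ ze∈)

      v-positive : 0ℚ < affine a 0ℚ (point (yr i))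
      v-positive = subst (0ℚ <_) (sym (trans (affine₀-point a (yr i)) value-at-yr)) 0<1

      value-at-q̃ : affine a 0ℚ q̃ ≡ - 1ℚ * q̃ c₁ + missing-ze-total
      value-at-q̃ = trans (+-identityʳ (dot a q̃)) (+-identityˡ (- 1ℚ * q̃ c₁ + missing-ze-total))

      q̃-negative : affine a 0ℚ q̃ < 0ℚ
      q̃-negative = subst (_< 0ℚ) (sym value-at-q̃) z-penalty

    visible-yl : ∀ {i} → LeftDouble i → VisibleFacet q̃ S (yl i)
    visible-yl {i} (yl∈ , ze∈) = a , 0ℚ , vanish , v-positive , q̃-negative
      where
      a : Pt m
      a = corner (- 1ℚ) 0ℚ missing-ze

      off-ze : ∀ K {b} → ze b ∉ S → value a (ev K b) ≡ value (corner (- 1ℚ) 0ℚ (λ _ → - 1ℚ)) (ev K b)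
      off-ze K {b} ze∉ = value-local K b refl refl (missing-ze-∉ ze∉)

      value-vanish : ∀ w → w ∈ S → w ≢ yl i → value a w ≡ 0ℚ
      value-vanish z₁     z₁∈  _    = contradiction z₁∈ (yl∈⇒z₁∉ yl∈)
      value-vanish z₂     _    _    = refl
      value-vanish (ze b) ze-b _    = missing-ze-∈ ze-b
      value-vanish (tt b) tt-b _    = off-ze kt (tt∈⇒ze∉ tt-b)
      value-vanish (yl b) yl-b w≢yl =
        off-ze kyl λ ze-b → w≢yl (cong yl (leftDouble-unique (yl-b , ze-b) (yl∈ , ze∈)))
      value-vanish (yr b) yr-b _    = contradiction yl∈ (yr∈⇒yl∉ yr-b)

      vanish : ∀ w → w ∈ S → w ≢ yl i → affine a 0ℚ (point w) ≡ 0ℚ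
      vanish w w∈ w≢yl = trans (affine₀-point a w) (value-vanish w w∈ w≢yl)

      value-at-yl : value a (yl i) ≡ 1ℚ
      value-at-yl = value-local {a = a} {corner (- 1ℚ) 0ℚ (λ _ → 0ℚ)} kyl i refl refl (missing-ze-∈ ze∈)

      v-positive : 0ℚ < affine a 0ℚ (point (yl i))
      v-positive = subst (0ℚ <_) (sym (trans (affine₀-point a (yl i)) value-at-yl)) 0<1

      value-at-q̃ : affine a 0ℚ q̃ ≡ - 1ℚ * q̃ c₁ + missing-ze-total
      value-at-q̃ = trans (+-identityʳ (dot a q̃)) (cong (- 1ℚ * q̃ c₁ +_) (+-identityˡ missing-ze-total))

      q̃-negative : affine a 0ℚ q̃ < 0ℚ
      q̃-negative = subst (_< 0ℚ) (sym value-at-q̃) z-penalty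

    Visible⇒VisibleFacet : ∀ {v} → v ∈ S → Visible v → VisibleFacet q̃ S v
    Visible⇒VisibleFacet tt∈ squiggly    = visible-tt tt∈
    Visible⇒VisibleFacet yr∈ (right ze∈) = visible-yr (yr∈ , ze∈)
    Visible⇒VisibleFacet yl∈ (left ze∈)  = visible-yl (yl∈ , ze∈)

  apex-kind : ∀ {i} → Dec (tt i ∈ S) → Dec (yr i ∈ S) → Kind
  apex-kind (yes _) _       = kt
  apex-kind (no _)  (yes _) = kyr
  apex-kind (no _)  (no _)  = kyl

  apex : Fin m → Var m
  apex i = ev (apex-kind (tt i ∈? S) (yr i ∈? S)) i

  apex-injective : ∀ {i j} → apex i ≡ apex j → i ≡ j
  apex-injective = ev-injectiveʳ
    where
    ev-injectiveʳ : ∀ {K L} {i j : Fin m} → ev K i ≡ ev L j → i ≡ j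
    ev-injectiveʳ refl = refl

  SquigglyOrDouble : Fin m → Set
  SquigglyOrDouble i = Squiggly S i ⊎ Double S i

  squigglyOrDouble? : ∀ i → Dec (SquigglyOrDouble i)
  squigglyOrDouble? i = (tt i ∈? S) ⊎-dec (countB (inEdge i) S ℕ.≟ 2)

  apex-visible : ∀ {i} → SquigglyOrDouble i → apex i ∈ S × Visible (apex i)
  apex-visible {i} sd with tt i ∈? S | yr i ∈? S | sd
  ... | yes tt∈ | _       | _           = tt∈ , squiggly
  ... | no tt∉  | _       | inj₁ tt∈    = contradiction tt∈ tt∉
  ... | no _    | yes yr∈ | inj₂ double = yr∈ , right ([ proj₂ , proj₂ ]′ (Equivalence.to Double⇔ double))
  ... | no _    | no yr∉  | inj₂ double with Equivalence.to Double⇔ double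
  ...   | inj₁ (yr∈ , _)   = contradiction yr∈ yr∉
  ...   | inj₂ (yl∈ , ze∈) = yl∈ , left ze∈

  visible⇒apex : ∀ {v} → v ∈ S → Visible v → ∃[ i ] SquigglyOrDouble i × apex i ≡ v
  visible⇒apex {tt i} tt∈ squiggly = i , inj₁ tt∈ , is-apex
    where
    is-apex : apex i ≡ tt i
    is-apex with tt i ∈? S
    ... | yes _   = refl
    ... | no tt∉  = contradiction tt∈ tt∉
  visible⇒apex {yr i} yr∈ (right ze∈) = i , inj₂ (Equivalence.from Double⇔ (inj₁ (yr∈ , ze∈))) , is-apex
    where
    is-apex : apex i ≡ yr i
    is-apex with tt i ∈? S | yr i ∈? S
    ... | yes tt∈ | _      = contradiction tt∈ (yr∈⇒tt∉ yr∈)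
    ... | no _    | yes _  = refl
    ... | no _    | no yr∉ = contradiction yr∈ yr∉
  visible⇒apex {yl i} yl∈ (left ze∈) = i , inj₂ (Equivalence.from Double⇔ (inj₂ (yl∈ , ze∈))) , is-apex
    where
    is-apex : apex i ≡ yl i
    is-apex with tt i ∈? S | yr i ∈? S
    ... | yes tt∈ | _       = contradiction tt∈ (yl∈⇒tt∉ yl∈)
    ... | no _    | yes yr∈ = contradiction yl∈ (yr∈⇒yl∉ yr∈)
    ... | no _    | no _    = refl

  squigglyOrDouble-edges : List (Fin m)
  squigglyOrDouble-edges = filter squigglyOrDouble? (allFin m)

  visible-vertices : List (Var m)
  visible-vertices = map apex squigglyOrDouble-edges

  squigglyOrDouble-edges-unique : Unique squigglyOrDouble-edges
  squigglyOrDouble-edges-unique = filter⁺ squigglyOrDouble? (allFin⁺ m)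

  visible-vertices-unique : Unique visible-vertices
  visible-vertices-unique = map⁺ apex-injective squigglyOrDouble-edges-unique

  ∈squigglyOrDouble-edges⇔ : ∀ i → i ∈ squigglyOrDouble-edges ⇔ SquigglyOrDouble i
  ∈squigglyOrDouble-edges⇔ i =
    mk⇔ (proj₂ ∘ ∈-filter⁻ squigglyOrDouble? {xs = allFin m}) (∈-filter⁺ squigglyOrDouble? (∈-allFin i))

  module _ .{{_ : NonZero m}} where

    ∈visible-vertices⇔ : ∀ v → v ∈ visible-vertices ⇔ (v ∈ S × VisibleFacet q̃ S v)
    ∈visible-vertices⇔ v = mk⇔ to from
      where
      to : v ∈ visible-vertices → v ∈ S × VisibleFacet q̃ S v
      to v∈ with i , i∈ , refl ← ∈-map⁻ apex v∈
            with apex∈ , visible ← apex-visible (Equivalence.to (∈squigglyOrDouble-edges⇔ i) i∈)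
        = apex∈ , Visible⇒VisibleFacet apex∈ visible

      from : v ∈ S × VisibleFacet q̃ S v → v ∈ visible-vertices
      from (v∈ , facet-visible) with i , sd , refl ← visible⇒apex v∈ (VisibleFacet⇒Visible v∈ facet-visible)
        = ∈-map⁺ apex (Equivalence.from (∈squigglyOrDouble-edges⇔ i) sd)

corollary4p13 : (m : ℕ) → .{{_ : NonZero m}} → (S : Mon m) → IsFacet m S →
    Σ ℕ λ n →
      NumberOf (λ v → v ∈ S × VisibleFacet (qt m) S v) n ×
      NumberOf (λ i → Squiggly S i ⊎ Double S i) n
corollary4p13 m S facet =
  length squigglyOrDouble-edges ,
  (visible-vertices , visible-vertices-unique , ∈visible-vertices⇔ , length-map apex squigglyOrDouble-edges) ,
  (squigglyOrDouble-edges , squigglyOrDouble-edges-unique , ∈squigglyOrDouble-edges⇔ , refl)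
  where open Facet facet
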